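{- Let $G$ be a finite graph and let $v$ be a vertex of $G$. Then $cop_{1}(G)\le cop_{1}(G-v)+1$, where $G-v$ denotes the graph obtained from $G$ by deleting $v$ and all edges incident to it.
   Context: The $1$-cop-move game with $c$ cops on a graph $G$ is the following perfect-information two-player game. Player $C$ first places each of $c$ cops at a vertex of $G$; then player $R$ places a robber at a vertex of $G$. Thereafter the players alternate turns, starting with $R$. On $R$'s turn, $R$ may either leave the robber where it is or move it along an edge to a neighbouring vertex. On $C$'s turn, $C$ may move at most one cop, by one step along an edge (or move no cop). Player $C$ wins if at some point some cop occupies the same vertex as the robber; otherwise $R$ wins. The $1$-cop-move number $cop_{1}(G)$ is the minimum $c$ such that player $C$ has a winning strategy in the $1$-cop-move game with $c$ cops on $G$. -}

module Defs where

open import Data.Nat using (ℕ; suc; _≤_)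
open import Data.Fin using (Fin; punchIn)
open import Data.Bool using (Bool; true; false)
open import Data.Vec using (Vec; lookup; _[_]≔_)
open import Data.Vec.Membership.Propositional using (_∈_)
open import Data.Product using (Σ; ∃; _×_; _,_)
open import Data.Sum using (_⊎_)
open import Relation.Binary.PropositionalEquality using (_≡_)

record Graph (n : ℕ) : Set where
  field
    Adj   : Fin n → Fin n → Bool
    sym   : ∀ u w → Adj u w ≡ Adj w u
    irrefl : ∀ u → Adj u u ≡ false
open Graph public

-- G - v : delete vertex v and all incident edges; vertices of G - v are
-- identified with Fin m via punchIn v.
_-ᵥ_ : ∀ {m} → Graph (suc m) → Fin (suc m) → Graph m
G -ᵥ v = record
  { Adj = λ i j → Adj G (punchIn v i) (punchIn v j)
  ; sym = λ i j → sym G (punchIn v i) (punchIn v j)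
  ; irrefl = λ i → irrefl G (punchIn v i) }

module _ {n : ℕ} (G : Graph n) where

  RobberStep : Fin n → Fin n → Set
  RobberStep r r' = (r' ≡ r) ⊎ (Adj G r r' ≡ true)

  CopStep : ∀ {c} → Vec (Fin n) c → Vec (Fin n) c → Set
  CopStep {c} cs cs' =
    (cs' ≡ cs) ⊎
    (Σ (Fin c) λ i → Σ (Fin n) λ u → (Adj G (lookup cs i) u ≡ true) × (cs' ≡ cs [ i ]≔ u))

  -- Positions from which player C can force capture (well-founded winning
  -- strategy tree).  WinR: robber to move; WinC: cops to move.
  mutual
    data WinR {c} (cs : Vec (Fin n) c) (r : Fin n) : Set where
      caughtR : r ∈ cs → WinR cs r
      moveR   : (∀ r' → RobberStep r r' → WinC cs r') → WinR cs r

    data WinC {c} (cs : Vec (Fin n) c) (r : Fin n) : Set where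
      caughtC : r ∈ cs → WinC cs r
      moveC   : ∀ cs' → CopStep cs cs' → WinR cs' r → WinC cs r

  -- C has a winning strategy in the 1-cop-move game with c cops:
  -- C places the cops, then R places the robber, then R moves first.
  CopWin : ℕ → Set
  CopWin c = Σ (Vec (Fin n) c) λ cs → ∀ r → WinR cs r

  IsCop₁ : ℕ → Set
  IsCop₁ k = CopWin k × (∀ c → CopWin c → k ≤ c)

{-# OPTIONS --safe #-}
module Submission where

open import Defs
open import Data.Nat using (ℕ; suc; _≤_)
open import Data.Fin using (Fin; punchIn; punchOut; _≟_)
import Data.Fin as Fin
open import Data.Fin.Properties using (punchIn-punchOut; punchIn-injective)
open import Data.Vec using (Vec; _∷_; map; lookup)
open import Data.Vec.Properties using (lookup-map; map-[]≔)
open import Data.Vec.Membership.Propositional using (_∈_)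
open import Data.Vec.Membership.Propositional.Properties using (∈-map⁺)
open import Data.Vec.Relation.Unary.Any using (here; there)
open import Data.Product using (_,_)
open import Data.Sum using (inj₁; inj₂)
open import Data.Bool using (true)
open import Relation.Nullary using (yes; no)
open import Relation.Binary.PropositionalEquality using (_≡_; refl; cong; subst)
import Relation.Binary.PropositionalEquality as ≡

-- Park the extra cop on v and never move it.  The robber can then never enter
-- v without being caught, so the play happens in G - v, where the other cops
-- follow a winning strategy for G - v transported along punchIn v, which
-- preserves and reflects adjacency by the definition of G - v.

data PunchInView {m} (v : Fin (suc m)) : Fin (suc m) → Set where
  pivot   : PunchInView v v
  punched : (r : Fin m) → PunchInView v (punchIn v r)

punchInView : ∀ {m} (v r : Fin (suc m)) → PunchInView v r
punchInView v r with v ≟ r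
... | yes refl = pivot
... | no v≢r   = subst (PunchInView v) (punchIn-punchOut v≢r) (punched (punchOut v≢r))

module _ {m} (G : Graph (suc m)) (v : Fin (suc m)) where

  guardVertex : ∀ {c} → Vec (Fin m) c → Vec (Fin (suc m)) (suc c)
  guardVertex cs = v ∷ map (punchIn v) cs

  guardVertex-caught : ∀ {c} {cs : Vec (Fin m) c} {r} →
    r ∈ cs → punchIn v r ∈ guardVertex cs
  guardVertex-caught r∈cs = there (∈-map⁺ (punchIn v) r∈cs)

  copStep-guardVertex : ∀ {c} {cs cs' : Vec (Fin m) c} →
    CopStep (G -ᵥ v) cs cs' → CopStep G (guardVertex cs) (guardVertex cs')
  copStep-guardVertex (inj₁ refl) = inj₁ refl
  copStep-guardVertex {cs = cs} (inj₂ (i , u , adj , refl)) =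
    inj₂ (Fin.suc i , punchIn v u , adj′ , cong (v ∷_) (map-[]≔ (punchIn v) cs i))
    where
    adj′ : Adj G (lookup (map (punchIn v) cs) i) (punchIn v u) ≡ true
    adj′ = subst (λ x → Adj G x (punchIn v u) ≡ true)
                 (≡.sym (lookup-map i (punchIn v) cs)) adj

  robberStep-restrict : ∀ {r r'} →
    RobberStep G (punchIn v r) (punchIn v r') → RobberStep (G -ᵥ v) r r'
  robberStep-restrict {r} {r'} (inj₁ eq) = inj₁ (punchIn-injective v r' r eq)
  robberStep-restrict (inj₂ adj) = inj₂ adj

  mutual
    winR-guardVertex : ∀ {c} {cs : Vec (Fin m) c} {r} →
      WinR (G -ᵥ v) cs r → WinR G (guardVertex cs) (punchIn v r)
    winR-guardVertex (caughtR r∈cs) = caughtR (guardVertex-caught r∈cs)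
    winR-guardVertex {cs = cs} {r} (moveR win) = moveR respond
      where
      respond : ∀ r'' → RobberStep G (punchIn v r) r'' → WinC G (guardVertex cs) r''
      respond r'' step with punchInView v r''
      ... | pivot      = caughtC (here refl)
      ... | punched r' = winC-guardVertex (win r' (robberStep-restrict step))

    winC-guardVertex : ∀ {c} {cs : Vec (Fin m) c} {r} →
      WinC (G -ᵥ v) cs r → WinC G (guardVertex cs) (punchIn v r)
    winC-guardVertex (caughtC r∈cs) = caughtC (guardVertex-caught r∈cs)
    winC-guardVertex (moveC cs' step win) =
      moveC (guardVertex cs') (copStep-guardVertex step) (winR-guardVertex win)

  copWin-deleteVertex : ∀ {c} → CopWin (G -ᵥ v) c → CopWin G (suc c)
  copWin-deleteVertex (cs , win) = guardVertex cs , start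
    where
    start : ∀ r → WinR G (guardVertex cs) r
    start r with punchInView v r
    ... | pivot      = caughtR (here refl)
    ... | punched r' = winR-guardVertex (win r')

mainTheorem2 : ∀ {m} (G : Graph (suc m)) (v : Fin (suc m)) (k k' : ℕ) →
    IsCop₁ G k → IsCop₁ (G -ᵥ v) k' → k ≤ suc k'
mainTheorem2 G v k k' (_ , minimal) (winG-v , _) =
  minimal (suc k') (copWin-deleteVertex G v winG-v)
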